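{- The satisfaction systems $\Lambda_{K3}$ (Kleene's 3-valued logic) and $\Lambda_{P3}$ (Priest's 3-valued logic) are both reception-compatible; moreover $\Lambda_{K3}$ is eviction-compatible, while $\Lambda_{P3}$ is not eviction-compatible.
   Context: Fix a finite set $\mathcal{P}$ of propositional atoms and let $\mathcal{L}_{\mathrm{Prop}}$ be the propositional language over $\mathcal{P}$ with connectives $\neg,\wedge,\vee$. Consider truth values $f<u<t$ (false, unknown, true). $\mathfrak{M}_3$ is the set of functions $v:\mathcal{L}_{\mathrm{Prop}}\to\{f,u,t\}$ with $v(\neg\varphi)=t,u,f$ when $v(\varphi)=f,u,t$ respectively, $v(\varphi\wedge\psi)=\min(v(\varphi),v(\psi))$, $v(\varphi\vee\psi)=\max(v(\varphi),v(\psi))$. $\Lambda_{K3}=(\mathcal{L}_{\mathrm{Prop}},\mathfrak{M}_3,\models_{K3})$ where $v\models_{K3}B$ iff $v(\varphi)=t$ for all $\varphi\in B$; $\Lambda_{P3}=(\mathcal{L}_{\mathrm{Prop}},\mathfrak{M}_3,\models_{P3})$ where $v\models_{P3}B$ iff $v(\varphi)\in\{t,u\}$ for all $\varphi\in B$. For a satisfaction system $\Lambda=(\mathcal{L},\mathfrak{M},\models)$: $\mathrm{Mod}(B)=\{m\in\mathfrak{M}\mid m\models B\}$; $\mathrm{FR}(\Lambda)=\{\mathrm{Mod}(B)\mid B\subseteq\mathcal{L}$ finite$\}$; $\mathrm{FRsubs}(\mathbb{M},\Lambda)$ is the set of $\subseteq$-maximal elements of $\{X\in\mathrm{FR}(\Lambda)\mid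 X\subseteq\mathbb{M}\}$ and $\mathrm{FRsups}(\mathbb{M},\Lambda)$ the set of $\subseteq$-minimal elements of $\{X\in\mathrm{FR}(\Lambda)\mid\mathbb{M}\subseteq X\}$. $\Lambda$ is eviction-compatible if $\mathrm{FRsubs}(\mathrm{Mod}(B)\setminus\mathbb{M},\Lambda)\neq\emptyset$ for all finite $B\subseteq\mathcal{L}$ and $\mathbb{M}\subseteq\mathfrak{M}$; it is reception-compatible if $\mathrm{FRsups}(\mathrm{Mod}(B)\cup\mathbb{M},\Lambda)\neq\emptyset$ for all finite $B$ and $\mathbb{M}$. -}

module Defs where

open import Data.Nat using (ℕ)
open import Data.Fin using (Fin)
open import Data.Vec using (Vec; lookup)
open import Data.List using (List)
open import Data.List.Relation.Unary.All using (All)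
open import Data.Bool using (Bool; true; false)
open import Data.Product using (Σ; _×_)
open import Data.Sum using (_⊎_)
open import Relation.Binary.PropositionalEquality using (_≡_)
open import Level using (Level; suc; zero)

-- Truth values f < u < t
data V3 : Set where
  f u t : V3

neg : V3 → V3
neg f = t
neg u = u
neg t = f

_⊓_ : V3 → V3 → V3
f ⊓ _ = f
u ⊓ f = f
u ⊓ u = u
u ⊓ t = u
t ⊓ y = y

_⊔_ : V3 → V3 → V3
f ⊔ y = y
u ⊔ f = u
u ⊔ u = u
u ⊔ t = t
t ⊔ _ = t

data Formula (n : ℕ) : Set where
  atom : Fin n → Formula n
  ¬'_  : Formula n → Formula n
  _∧'_ : Formula n → Formula n → Formula n
  _∨'_ : Formula n → Formula n → Formula n

-- A valuation in 𝔐₃ is uniquely determined by its values on the atoms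
-- (it is the homomorphic extension of an atom assignment); we represent
-- 𝔐₃ by atom assignments, and ⟦ φ ⟧ v is the value v(φ).
Valuation : ℕ → Set
Valuation n = Vec V3 n

⟦_⟧ : ∀ {n} → Formula n → Valuation n → V3
⟦ atom p ⟧ v = lookup v p
⟦ ¬' φ ⟧ v = neg (⟦ φ ⟧ v)
⟦ φ ∧' ψ ⟧ v = ⟦ φ ⟧ v ⊓ ⟦ ψ ⟧ v
⟦ φ ∨' ψ ⟧ v = ⟦ φ ⟧ v ⊔ ⟦ ψ ⟧ v

-- Satisfaction relations (on finite sets B of formulas, given as lists)
_⊨K3_ : ∀ {n} → Valuation n → List (Formula n) → Set
v ⊨K3 B = All (λ φ → ⟦ φ ⟧ v ≡ t) B

_⊨P3_ : ∀ {n} → Valuation n → List (Formula n) → Set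
v ⊨P3 B = All (λ φ → (⟦ φ ⟧ v ≡ t) ⊎ (⟦ φ ⟧ v ≡ u)) B

SatRel : ℕ → Set₁
SatRel n = Valuation n → List (Formula n) → Set

ModelSet : ℕ → Set₁
ModelSet n = Valuation n → Set

_⊆_ : ∀ {n} → ModelSet n → ModelSet n → Set
X ⊆ Y = ∀ v → X v → Y v

Mod : ∀ {n} → SatRel n → List (Formula n) → ModelSet n
Mod _⊨_ B v = v ⊨ B

-- X ∈ FR(Λ): X = Mod(B) for some finite B (set equality = mutual inclusion)
IsFR : ∀ {n} → SatRel n → ModelSet n → Set
IsFR _⊨_ X = Σ (List _) λ B → (X ⊆ Mod _⊨_ B) × (Mod _⊨_ B ⊆ X)

-- FRsubs(S, Λ) ≠ ∅ : there is a ⊆-maximal FR set contained in S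
FRsubsNonempty : ∀ {n} → SatRel n → ModelSet n → Set₁
FRsubsNonempty _⊨_ S =
  Σ (ModelSet _) λ X → IsFR _⊨_ X × (X ⊆ S) ×
    (∀ (Y : ModelSet _) → IsFR _⊨_ Y → Y ⊆ S → X ⊆ Y → Y ⊆ X)

-- FRsups(S, Λ) ≠ ∅ : there is a ⊆-minimal FR set containing S
FRsupsNonempty : ∀ {n} → SatRel n → ModelSet n → Set₁
FRsupsNonempty _⊨_ S =
  Σ (ModelSet _) λ X → IsFR _⊨_ X × (S ⊆ X) ×
    (∀ (Y : ModelSet _) → IsFR _⊨_ Y → S ⊆ Y → Y ⊆ X → X ⊆ Y)

-- Arbitrary subsets 𝕄 ⊆ 𝔐₃ (a finite set) are given by characteristic functions
SubsetM : ℕ → Set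
SubsetM n = Valuation n → Bool

_∖_ : ∀ {n} → ModelSet n → SubsetM n → ModelSet n
(X ∖ M) v = X v × (M v ≡ false)

_∪_ : ∀ {n} → ModelSet n → SubsetM n → ModelSet n
(X ∪ M) v = X v ⊎ (M v ≡ true)

EvictionCompatible : ∀ {n} → SatRel n → Set₁
EvictionCompatible {n} _⊨_ =
  ∀ (B : List (Formula n)) (M : SubsetM n) → FRsubsNonempty _⊨_ (Mod _⊨_ B ∖ M)

ReceptionCompatible : ∀ {n} → SatRel n → Set₁
ReceptionCompatible {n} _⊨_ =
  ∀ (B : List (Formula n)) (M : SubsetM n) → FRsupsNonempty _⊨_ (Mod _⊨_ B ∪ M)

-- All connectives are monotone for the information order, in which u lies below the two
-- incomparable classical values.  Since t is maximal and {t, u} is down-closed in that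
-- order, K3 model sets are up-closed and P3 model sets are down-closed and contain the
-- all-u valuation ⊥ᵥ.  Conversely, designated values are join-prime, so FR sets are closed
-- under finite unions, and principal up-sets (K3) and down-sets (P3) are cut out by
-- literals.  Hence the up-closure of S is its least K3 FR superset, its up-interior is its
-- greatest K3 FR subset, and the down-closure of S ∪ {⊥ᵥ} is its least P3 FR superset;
-- but no P3 FR set fits inside the complement of {⊥ᵥ}.
module Submission where

open import Defs
open import Data.Nat using (ℕ; NonZero; zero; suc)
open import Data.Fin using (Fin; zero)
open import Data.Vec using ([]; _∷_; lookup; replicate)
open import Data.Vec.Properties using (lookup-replicate)
open import Data.Vec.Relation.Binary.Pointwise.Extensional as Pointwise using (Pointwise; ext)
open import Data.List using (List; []; _∷_; [_]; map; concat; tabulate; foldr; filter; cartesianProductWith)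
open import Data.List.Relation.Unary.All as All using (All; []; _∷_)
import Data.List.Relation.Unary.All.Properties as All
open import Data.List.Relation.Unary.Any as Any using (Any; here; there)
import Data.List.Relation.Unary.Any.Properties as Any
open import Data.List.Membership.Propositional using (_∈_; find; lose)
open import Data.List.Membership.Propositional.Properties using (∈-cartesianProductWith⁺; ∈-filter⁺; ∈-filter⁻)
open import Data.Bool as Bool using (true; false)
open import Data.Empty using (⊥-elim)
open import Data.Product using (_×_; _,_; ∃-syntax; proj₂)
open import Data.Sum as Sum using (_⊎_; inj₁; inj₂; [_,_]′)
open import Function using (_∘_; id; case_of_; _⇔_; mk⇔; Equivalence)
open import Relation.Nullary using (¬_; Dec; yes; no; does)
open import Relation.Nullary.Decidable using (map′; _×-dec_; _⊎-dec_; _→-dec_; dec-true)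
open import Relation.Unary using (Decidable)
open import Relation.Binary.PropositionalEquality using (_≡_; _≢_; refl; sym; trans)
open import Function.Construct.Composition using (_⇔-∘_)

open Equivalence using (to; from)

private
  variable
    n : ℕ
    x y x′ y′ : V3

infix 4 _⊑_ _⊑?_ _≼_ _≟_

_≟_ : (x y : V3) → Dec (x ≡ y)
f ≟ f = yes refl
f ≟ u = no λ ()
f ≟ t = no λ ()
u ≟ f = no λ ()
u ≟ u = yes refl
u ≟ t = no λ ()
t ≟ f = no λ ()
t ≟ u = no λ ()
t ≟ t = yes refl

data _⊑_ : V3 → V3 → Set where
  u⊑     : u ⊑ x
  ⊑-refl : x ⊑ x

⊑-trans : ∀ {z} → x ⊑ y → y ⊑ z → x ⊑ z
⊑-trans u⊑     _ = u⊑
⊑-trans ⊑-refl q = q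

_⊑?_ : (x y : V3) → Dec (x ⊑ y)
u ⊑? _ = yes u⊑
f ⊑? f = yes ⊑-refl
f ⊑? u = no λ ()
f ⊑? t = no λ ()
t ⊑? f = no λ ()
t ⊑? u = no λ ()
t ⊑? t = yes ⊑-refl

neg-mono : x ⊑ y → neg x ⊑ neg y
neg-mono u⊑     = u⊑
neg-mono ⊑-refl = ⊑-refl

⊓-mono : x ⊑ x′ → y ⊑ y′ → x ⊓ y ⊑ x′ ⊓ y′
⊓-mono ⊑-refl ⊑-refl = ⊑-refl
⊓-mono u⊑ u⊑ = u⊑
⊓-mono {x = f} ⊑-refl u⊑ = ⊑-refl
⊓-mono {x = u} ⊑-refl u⊑ = u⊑
⊓-mono {x = t} ⊑-refl u⊑ = u⊑
⊓-mono {x′ = f} {y = f} u⊑ ⊑-refl = ⊑-refl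
⊓-mono {x′ = u} {y = f} u⊑ ⊑-refl = ⊑-refl
⊓-mono {x′ = t} {y = f} u⊑ ⊑-refl = ⊑-refl
⊓-mono {y = u} u⊑ ⊑-refl = u⊑
⊓-mono {y = t} u⊑ ⊑-refl = u⊑

⊔-mono : x ⊑ x′ → y ⊑ y′ → x ⊔ y ⊑ x′ ⊔ y′
⊔-mono ⊑-refl ⊑-refl = ⊑-refl
⊔-mono u⊑ u⊑ = u⊑
⊔-mono {x = f} ⊑-refl u⊑ = u⊑
⊔-mono {x = u} ⊑-refl u⊑ = u⊑
⊔-mono {x = t} ⊑-refl u⊑ = ⊑-refl
⊔-mono {x′ = f} {y = t} u⊑ ⊑-refl = ⊑-refl
⊔-mono {x′ = u} {y = t} u⊑ ⊑-refl = ⊑-refl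
⊔-mono {x′ = t} {y = t} u⊑ ⊑-refl = ⊑-refl
⊔-mono {y = u} u⊑ ⊑-refl = u⊑
⊔-mono {y = f} u⊑ ⊑-refl = u⊑

_≼_ : Valuation n → Valuation n → Set
_≼_ = Pointwise _⊑_

_≼?_ : (v w : Valuation n) → Dec (v ≼ w)
_≼?_ = Pointwise.decidable _⊑?_

≼-refl : {v : Valuation n} → v ≼ v
≼-refl = Pointwise.refl ⊑-refl

≼-trans : {v w z : Valuation n} → v ≼ w → w ≼ z → v ≼ z
≼-trans = Pointwise.trans ⊑-trans

⟦⟧-mono : (φ : Formula n) {v w : Valuation n} → v ≼ w → ⟦ φ ⟧ v ⊑ ⟦ φ ⟧ w
⟦⟧-mono (atom p)  h = Pointwise.app h p
⟦⟧-mono (¬' φ)    h = neg-mono (⟦⟧-mono φ h)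
⟦⟧-mono (φ ∧' ψ)  h = ⊓-mono (⟦⟧-mono φ h) (⟦⟧-mono ψ h)
⟦⟧-mono (φ ∨' ψ)  h = ⊔-mono (⟦⟧-mono φ h) (⟦⟧-mono ψ h)

⊥ᵥ : (n : ℕ) → Valuation n
⊥ᵥ n = replicate n u

⟦⟧-⊥ᵥ : (φ : Formula n) → ⟦ φ ⟧ (⊥ᵥ n) ≡ u
⟦⟧-⊥ᵥ {n} (atom p) = lookup-replicate {n = n} p u
⟦⟧-⊥ᵥ (¬' φ)   rewrite ⟦⟧-⊥ᵥ φ = refl
⟦⟧-⊥ᵥ (φ ∧' ψ) rewrite ⟦⟧-⊥ᵥ φ | ⟦⟧-⊥ᵥ ψ = refl
⟦⟧-⊥ᵥ (φ ∨' ψ) rewrite ⟦⟧-⊥ᵥ φ | ⟦⟧-⊥ᵥ ψ = refl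

valuations : (n : ℕ) → List (Valuation n)
valuations zero    = [ [] ]
valuations (suc n) = cartesianProductWith _∷_ (f ∷ u ∷ t ∷ []) (valuations n)

∈-valuations : (v : Valuation n) → v ∈ valuations n
∈-valuations []      = here refl
∈-valuations (x ∷ v) = ∈-cartesianProductWith⁺ _∷_ (∈-values x) (∈-valuations v)
  where
  ∈-values : ∀ x → x ∈ f ∷ u ∷ t ∷ []
  ∈-values f = here refl
  ∈-values u = there (here refl)
  ∈-values t = there (there (here refl))

∀-valuations? : {P : Valuation n → Set} → Decidable P → Dec (∀ v → P v)
∀-valuations? {n} P? =
  map′ (λ h v → All.lookup h (∈-valuations v)) (λ h → All.tabulate λ {v} _ → h v)
       (All.all? P? (valuations n))

_∨ᴸ_ : List (Formula n) → List (Formula n) → List (Formula n)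
_∨ᴸ_ = cartesianProductWith _∨'_

literals : (Fin n → V3 → List (Formula n)) → Valuation n → List (Formula n)
literals ℓ w = concat (tabulate λ i → ℓ i (lookup w i))

module Designated (D : V3 → Set) (D? : Decidable D)
                  (D-⊔ : ∀ x y → D (x ⊔ y) ⇔ (D x ⊎ D y)) {n : ℕ} where

  infix 4 _⊨_
  _⊨_ : Valuation n → List (Formula n) → Set
  v ⊨ B = All (λ φ → D (⟦ φ ⟧ v)) B

  _⊨?_ : (v : Valuation n) (B : List (Formula n)) → Dec (v ⊨ B)
  v ⊨? B = All.all? (λ φ → D? (⟦ φ ⟧ v)) B

  ⊨-∨ᴸ⁺ : ∀ {v} B C → v ⊨ B ⊎ v ⊨ C → v ⊨ B ∨ᴸ C
  ⊨-∨ᴸ⁺ []      C _ = []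
  ⊨-∨ᴸ⁺ (φ ∷ B) C (inj₁ (dφ ∷ dB)) =
    All.++⁺ (All.map⁺ (All.tabulate λ _ → from (D-⊔ _ _) (inj₁ dφ))) (⊨-∨ᴸ⁺ B C (inj₁ dB))
  ⊨-∨ᴸ⁺ (φ ∷ B) C (inj₂ dC) =
    All.++⁺ (All.map⁺ (All.map (λ dψ → from (D-⊔ _ _) (inj₂ dψ)) dC)) (⊨-∨ᴸ⁺ B C (inj₂ dC))

  D-⊔-resolve : ∀ {x y} → ¬ D x → D (x ⊔ y) → D y
  D-⊔-resolve ¬dx d = [ ⊥-elim ∘ ¬dx , id ]′ (to (D-⊔ _ _) d)

  ⊨-∨ᴸ⁻ : ∀ {v} B C → v ⊨ B ∨ᴸ C → v ⊨ B ⊎ v ⊨ C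
  ⊨-∨ᴸ⁻ []      C _ = inj₁ []
  ⊨-∨ᴸ⁻ {v} (φ ∷ B) C d with All.++⁻ (map (φ ∨'_) C) d
  ... | dφC , dBC with D? (⟦ φ ⟧ v)
  ...   | no ¬dφ = inj₂ (All.map (D-⊔-resolve ¬dφ) (All.map⁻ dφC))
  ...   | yes dφ = Sum.map₁ (dφ ∷_) (⊨-∨ᴸ⁻ B C dBC)

  ⊨-⋁⁺ : ∀ {v} Z Bs → v ⊨ Z ⊎ Any (v ⊨_) Bs → v ⊨ foldr _∨ᴸ_ Z Bs
  ⊨-⋁⁺ Z []       (inj₁ dZ)         = dZ
  ⊨-⋁⁺ Z (B ∷ Bs) (inj₂ (here dB))  = ⊨-∨ᴸ⁺ B _ (inj₁ dB)
  ⊨-⋁⁺ Z (B ∷ Bs) (inj₂ (there dBs)) = ⊨-∨ᴸ⁺ B _ (inj₂ (⊨-⋁⁺ Z Bs (inj₂ dBs)))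
  ⊨-⋁⁺ Z (B ∷ Bs) (inj₁ dZ)         = ⊨-∨ᴸ⁺ B _ (inj₂ (⊨-⋁⁺ Z Bs (inj₁ dZ)))

  ⊨-⋁⁻ : ∀ {v} Z Bs → v ⊨ foldr _∨ᴸ_ Z Bs → v ⊨ Z ⊎ Any (v ⊨_) Bs
  ⊨-⋁⁻ Z []       dZ = inj₁ dZ
  ⊨-⋁⁻ Z (B ∷ Bs) d  with ⊨-∨ᴸ⁻ B _ d
  ... | inj₁ dB  = inj₂ (here dB)
  ... | inj₂ dBs = Sum.map₂ there (⊨-⋁⁻ Z Bs dBs)

  ⋃-FR : (Z : List (Formula n)) (P : Valuation n → List (Formula n)) {S : Valuation n → Set} →
         Decidable S → IsFR _⊨_ (λ v → v ⊨ Z ⊎ ∃[ w ] S w × v ⊨ P w)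
  ⋃-FR Z P {S} S? = foldr _∨ᴸ_ Z Bs , intro , elim
    where
    Bs : List (List (Formula n))
    Bs = map P (filter S? (valuations n))
    intro : ∀ v → v ⊨ Z ⊎ ∃[ w ] S w × v ⊨ P w → v ⊨ foldr _∨ᴸ_ Z Bs
    intro v (inj₁ dZ)          = ⊨-⋁⁺ Z Bs (inj₁ dZ)
    intro v (inj₂ (w , s , d)) = ⊨-⋁⁺ Z Bs (inj₂ (Any.map⁺ (lose (∈-filter⁺ S? (∈-valuations w) s) d)))
    elim : ∀ v → v ⊨ foldr _∨ᴸ_ Z Bs → v ⊨ Z ⊎ ∃[ w ] S w × v ⊨ P w
    elim v d with ⊨-⋁⁻ Z Bs d
    ... | inj₁ dZ = inj₁ dZ
    ... | inj₂ a with find (Any.map⁻ a)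
    ...   | w , w∈ , dw = inj₂ (w , proj₂ (∈-filter⁻ S? {xs = valuations n} w∈) , dw)

  ⊨-literals : ∀ {v} {R : Fin n → V3 → Set} ℓ w →
               (∀ i x → R i x ⇔ v ⊨ ℓ i x) → (∀ i → R i (lookup w i)) ⇔ v ⊨ literals ℓ w
  ⊨-literals ℓ w ℓ⇔ = mk⇔ (λ h → All.concat⁺ (All.tabulate⁺ λ i → to (ℓ⇔ i _) (h i)))
                           (λ d i → from (ℓ⇔ i _) (All.tabulate⁻ (All.concat⁻ d) i))

≡t-⊔ : ∀ x y → (x ⊔ y ≡ t) ⇔ (x ≡ t ⊎ y ≡ t)
≡t-⊔ x y = mk⇔ (to′ x y) (from′ x y)
  where
  to′ : ∀ x y → x ⊔ y ≡ t → x ≡ t ⊎ y ≡ t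
  to′ f y e = inj₂ e
  to′ u t e = inj₂ refl
  to′ t y e = inj₁ refl
  from′ : ∀ x y → x ≡ t ⊎ y ≡ t → x ⊔ y ≡ t
  from′ t y _        = refl
  from′ f y (inj₂ e) = e
  from′ u t _        = refl
  from′ f y (inj₁ ())
  from′ u y (inj₁ ())
  from′ u f (inj₂ ())
  from′ u u (inj₂ ())

TrueOrUnknown : V3 → Set
TrueOrUnknown x = x ≡ t ⊎ x ≡ u

TrueOrUnknown-⊔ : ∀ x y → TrueOrUnknown (x ⊔ y) ⇔ (TrueOrUnknown x ⊎ TrueOrUnknown y)
TrueOrUnknown-⊔ x y = mk⇔ (to′ x y) (from′ x y)
  where
  to′ : ∀ x y → TrueOrUnknown (x ⊔ y) → TrueOrUnknown x ⊎ TrueOrUnknown y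
  to′ f y d = inj₂ d
  to′ u y d = inj₁ (inj₂ refl)
  to′ t y d = inj₁ (inj₁ refl)
  from′ : ∀ x y → TrueOrUnknown x ⊎ TrueOrUnknown y → TrueOrUnknown (x ⊔ y)
  from′ t y _ = inj₁ refl
  from′ u f _ = inj₂ refl
  from′ u u _ = inj₂ refl
  from′ u t _ = inj₁ refl
  from′ f y (inj₂ d) = d
  from′ f y (inj₁ (inj₁ ()))
  from′ f y (inj₁ (inj₂ ()))

module K3 = Designated (_≡ t) (_≟ t) ≡t-⊔
module P3 = Designated TrueOrUnknown (λ x → x ≟ t ⊎-dec x ≟ u) TrueOrUnknown-⊔

contradictory : Fin n → Formula n
contradictory i = atom i ∧' (¬' atom i)

upLiteral : Fin n → V3 → List (Formula n)
upLiteral i f = [ ¬' atom i ]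
upLiteral i u = []
upLiteral i t = [ atom i ]

downLiteral : Fin n → V3 → List (Formula n)
downLiteral i f = [ ¬' atom i ]
downLiteral i u = [ contradictory i ]
downLiteral i t = [ atom i ]

upLiterals downLiterals : Valuation n → List (Formula n)
upLiterals   = literals upLiteral
downLiterals = literals downLiteral

All-singleton : ∀ {A : Set} {P : A → Set} {a} → P a ⇔ All P [ a ]
All-singleton = mk⇔ (_∷ []) All.singleton⁻

t⊑⇔≡t : ∀ y → t ⊑ y ⇔ y ≡ t
t⊑⇔≡t y = mk⇔ (λ { ⊑-refl → refl }) (λ { refl → ⊑-refl })

f⊑⇔neg≡t : ∀ y → f ⊑ y ⇔ neg y ≡ t
f⊑⇔neg≡t y = mk⇔ (λ { ⊑-refl → refl }) (from′ y)
  where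
  from′ : ∀ y → neg y ≡ t → f ⊑ y
  from′ f _ = ⊑-refl

⊑t⇔TrueOrUnknown : ∀ y → y ⊑ t ⇔ TrueOrUnknown y
⊑t⇔TrueOrUnknown y = mk⇔ (λ { u⊑ → inj₂ refl ; ⊑-refl → inj₁ refl }) (from′ y)
  where
  from′ : ∀ y → TrueOrUnknown y → y ⊑ t
  from′ f (inj₁ ())
  from′ f (inj₂ ())
  from′ u _ = u⊑
  from′ t _ = ⊑-refl

⊑f⇔TrueOrUnknown-neg : ∀ y → y ⊑ f ⇔ TrueOrUnknown (neg y)
⊑f⇔TrueOrUnknown-neg y = mk⇔ (λ { u⊑ → inj₂ refl ; ⊑-refl → inj₁ refl }) (from′ y)
  where
  from′ : ∀ y → TrueOrUnknown (neg y) → y ⊑ f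
  from′ f _ = ⊑-refl
  from′ u _ = u⊑
  from′ t (inj₁ ())
  from′ t (inj₂ ())

⊑u⇔TrueOrUnknown-contradictory : ∀ y → y ⊑ u ⇔ TrueOrUnknown (y ⊓ neg y)
⊑u⇔TrueOrUnknown-contradictory y = mk⇔ (λ { u⊑ → inj₂ refl ; ⊑-refl → inj₂ refl }) (from′ y)
  where
  from′ : ∀ y → TrueOrUnknown (y ⊓ neg y) → y ⊑ u
  from′ f (inj₁ ())
  from′ f (inj₂ ())
  from′ u _ = ⊑-refl
  from′ t (inj₁ ())
  from′ t (inj₂ ())

contradictory≢t : ∀ y → y ⊓ neg y ≢ t
contradictory≢t f ()
contradictory≢t u ()
contradictory≢t t ()

⊨-upLiterals : (v w : Valuation n) → w ≼ v ⇔ v K3.⊨ upLiterals w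
⊨-upLiterals v w = K3.⊨-literals upLiteral w ⊨-upLiteral ⇔-∘ mk⇔ Pointwise.app ext
  where
  ⊨-upLiteral : ∀ i x → x ⊑ lookup v i ⇔ v K3.⊨ upLiteral i x
  ⊨-upLiteral i f = All-singleton ⇔-∘ f⊑⇔neg≡t (lookup v i)
  ⊨-upLiteral i u = mk⇔ (λ _ → []) (λ _ → u⊑)
  ⊨-upLiteral i t = All-singleton ⇔-∘ t⊑⇔≡t (lookup v i)

⊨-downLiterals : (v w : Valuation n) → v ≼ w ⇔ v P3.⊨ downLiterals w
⊨-downLiterals v w = P3.⊨-literals downLiteral w ⊨-downLiteral ⇔-∘ mk⇔ Pointwise.app ext
  where
  ⊨-downLiteral : ∀ i x → lookup v i ⊑ x ⇔ v P3.⊨ downLiteral i x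
  ⊨-downLiteral i f = All-singleton ⇔-∘ ⊑f⇔TrueOrUnknown-neg (lookup v i)
  ⊨-downLiteral i u = All-singleton ⇔-∘ ⊑u⇔TrueOrUnknown-contradictory (lookup v i)
  ⊨-downLiteral i t = All-singleton ⇔-∘ ⊑t⇔TrueOrUnknown (lookup v i)

IsFR-cong : ∀ {_⊨_ : SatRel n} {X Y : ModelSet n} → IsFR _⊨_ Y → X ⊆ Y → Y ⊆ X → IsFR _⊨_ X
IsFR-cong (B , Y⊆ , ⊆Y) X⊆Y Y⊆X = B , (λ v → Y⊆ v ∘ X⊆Y v) , (λ v → Y⊆X v ∘ ⊆Y v)

least⇒FRsupsNonempty : ∀ {_⊨_ : SatRel n} {S X : ModelSet n} → IsFR _⊨_ X → S ⊆ X →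
                       (∀ Y → IsFR _⊨_ Y → S ⊆ Y → X ⊆ Y) → FRsupsNonempty _⊨_ S
least⇒FRsupsNonempty frX S⊆X least = _ , frX , S⊆X , λ Y frY S⊆Y _ → least Y frY S⊆Y

greatest⇒FRsubsNonempty : ∀ {_⊨_ : SatRel n} {S X : ModelSet n} → IsFR _⊨_ X → X ⊆ S →
                          (∀ Y → IsFR _⊨_ Y → Y ⊆ S → Y ⊆ X) → FRsubsNonempty _⊨_ S
greatest⇒FRsubsNonempty frX X⊆S greatest = _ , frX , X⊆S , λ Y frY Y⊆S _ → greatest Y frY Y⊆S

∪-dec : {X : ModelSet n} → Decidable X → (M : SubsetM n) → Decidable (X ∪ M)
∪-dec X? M v = X? v ⊎-dec M v Bool.≟ true

∖-dec : {X : ModelSet n} → Decidable X → (M : SubsetM n) → Decidable (X ∖ M)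
∖-dec X? M v = X? v ×-dec M v Bool.≟ false

⊨K3-mono : (B : List (Formula n)) {v w : Valuation n} → v ≼ w → v ⊨K3 B → w ⊨K3 B
⊨K3-mono B v≼w = All.map λ {φ} → ≡t-mono (⟦⟧-mono φ v≼w)
  where
  ≡t-mono : x ⊑ y → x ≡ t → y ≡ t
  ≡t-mono ⊑-refl e = e

⊨P3-antitone : (B : List (Formula n)) {v w : Valuation n} → v ≼ w → w ⊨P3 B → v ⊨P3 B
⊨P3-antitone B v≼w = All.map λ {φ} → TrueOrUnknown-antitone (⟦⟧-mono φ v≼w)
  where
  TrueOrUnknown-antitone : x ⊑ y → TrueOrUnknown y → TrueOrUnknown x
  TrueOrUnknown-antitone u⊑     _ = inj₂ refl
  TrueOrUnknown-antitone ⊑-refl d = d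

⊥ᵥ-⊨P3 : (B : List (Formula n)) → ⊥ᵥ n ⊨P3 B
⊥ᵥ-⊨P3 B = All.tabulate λ {φ} _ → inj₂ (⟦⟧-⊥ᵥ φ)

FR-K3-upClosed : {Y : ModelSet n} → IsFR _⊨K3_ Y → {v w : Valuation n} → v ≼ w → Y v → Y w
FR-K3-upClosed (B , Y⊆ , ⊆Y) v≼w y = ⊆Y _ (⊨K3-mono B v≼w (Y⊆ _ y))

FR-P3-downClosed : {Y : ModelSet n} → IsFR _⊨P3_ Y → {v w : Valuation n} → v ≼ w → Y w → Y v
FR-P3-downClosed (B , Y⊆ , ⊆Y) v≼w y = ⊆Y _ (⊨P3-antitone B v≼w (Y⊆ _ y))

FR-P3-⊥ᵥ : {Y : ModelSet n} → IsFR _⊨P3_ Y → Y (⊥ᵥ n)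
FR-P3-⊥ᵥ (B , _ , ⊆Y) = ⊆Y _ (⊥ᵥ-⊨P3 B)

infix 21 ↑_ ↓_

↑_ ↓_ : (Valuation n → Set) → ModelSet n
(↑ S) v = ∃[ w ] S w × w ≼ v
(↓ S) v = ∃[ w ] S w × v ≼ w

-- The seed [ contradictory zero ] has no K3 models; writing it down needs an atom.
↑-FR : ∀ {m} {S : Valuation (suc m) → Set} → Decidable S → IsFR _⊨K3_ (↑ S)
↑-FR S? = IsFR-cong (K3.⋃-FR [ contradictory zero ] upLiterals S?)
  (λ v (w , s , w≼v) → inj₂ (w , s , to (⊨-upLiterals v w) w≼v))
  (λ v → [ (λ { (e ∷ []) → ⊥-elim (contradictory≢t (lookup v zero) e) })
         , (λ (w , s , d) → w , s , from (⊨-upLiterals v w) d) ]′)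

↓⊥ᵥ-FR : {S : Valuation n → Set} → Decidable S → IsFR _⊨P3_ (λ v → v ≼ ⊥ᵥ n ⊎ (↓ S) v)
↓⊥ᵥ-FR {n} S? = IsFR-cong (P3.⋃-FR (downLiterals (⊥ᵥ n)) downLiterals S?)
  (λ v → Sum.map (to (⊨-downLiterals v (⊥ᵥ n))) λ (w , s , v≼w) → w , s , to (⊨-downLiterals v w) v≼w)
  (λ v → Sum.map (from (⊨-downLiterals v (⊥ᵥ n))) λ (w , s , d) → w , s , from (⊨-downLiterals v w) d)

UpClosed : ModelSet n → Set
UpClosed X = ∀ {v w} → v ≼ w → X v → X w

Interior : (Valuation n → Set) → ModelSet n
Interior S v = ∀ w → v ≼ w → S w

Interior-upClosed : (S : Valuation n → Set) → UpClosed (Interior S)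
Interior-upClosed S v≼w int z w≼z = int z (≼-trans v≼w w≼z)

upClosed-FR : ∀ {m} {X : ModelSet (suc m)} → Decidable X → UpClosed X → IsFR _⊨K3_ X
upClosed-FR X? up = IsFR-cong (↑-FR X?) (λ v x → v , x , ≼-refl) (λ v (w , x , w≼v) → up w≼v x)

K3-receptionCompatible : ∀ {m} → ReceptionCompatible {suc m} _⊨K3_
K3-receptionCompatible B M =
  least⇒FRsupsNonempty (↑-FR (∪-dec (K3._⊨? B) M)) (λ v s → v , s , ≼-refl)
    λ Y frY S⊆Y v (w , s , w≼v) → FR-K3-upClosed frY w≼v (S⊆Y w s)

P3-receptionCompatible : ReceptionCompatible {n} _⊨P3_
P3-receptionCompatible B M =
  least⇒FRsupsNonempty (↓⊥ᵥ-FR (∪-dec (P3._⊨? B) M)) (λ v s → inj₂ (v , s , ≼-refl)) least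
  where
  least : ∀ Y → IsFR _⊨P3_ Y → (Mod _⊨P3_ B ∪ M) ⊆ Y → (λ v → v ≼ ⊥ᵥ _ ⊎ (↓ (Mod _⊨P3_ B ∪ M)) v) ⊆ Y
  least Y frY S⊆Y v (inj₁ v≼⊥)          = FR-P3-downClosed frY v≼⊥ (FR-P3-⊥ᵥ frY)
  least Y frY S⊆Y v (inj₂ (w , s , v≼w)) = FR-P3-downClosed frY v≼w (S⊆Y w s)

K3-evictionCompatible : ∀ {m} → EvictionCompatible {suc m} _⊨K3_
K3-evictionCompatible B M =
  greatest⇒FRsubsNonempty (upClosed-FR interior? (Interior-upClosed _)) (λ v int → int v ≼-refl)
    λ Y frY Y⊆S v y w v≼w → Y⊆S w (FR-K3-upClosed frY v≼w y)
  where
  interior? : Decidable (Interior (Mod _⊨K3_ B ∖ M))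
  interior? v = ∀-valuations? λ w → v ≼? w →-dec ∖-dec (K3._⊨? B) M w

P3-not-evictionCompatible : ¬ EvictionCompatible {n} _⊨P3_
P3-not-evictionCompatible {n} ec with ec [] (λ v → does (v ≼? ⊥ᵥ n))
... | X , frX , X⊆S , _ with X⊆S (⊥ᵥ n) (FR-P3-⊥ᵥ frX)
...   | _ , ⊥∉M = case trans (sym (dec-true (⊥ᵥ n ≼? ⊥ᵥ n) ≼-refl)) ⊥∉M of λ ()

¬Formula0 : ¬ Formula 0
¬Formula0 (¬' φ)   = ¬Formula0 φ
¬Formula0 (φ ∧' _) = ¬Formula0 φ
¬Formula0 (φ ∨' _) = ¬Formula0 φ

K3-receptionCompatible₀ : ReceptionCompatible {0} _⊨K3_
K3-receptionCompatible₀ B M =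
  least⇒FRsupsNonempty ([] , (λ _ d → d) , (λ _ d → d)) (λ _ _ → [])
    λ { Y (BY , _ , ⊆Y) _ v _ → ⊆Y v (All.tabulate λ {φ} _ → ⊥-elim (¬Formula0 φ)) }

theorem6 : (n : ℕ) →
    (ReceptionCompatible {n} _⊨K3_ × ReceptionCompatible {n} _⊨P3_) ×
    (NonZero n → EvictionCompatible {n} _⊨K3_ × ¬ EvictionCompatible {n} _⊨P3_)
theorem6 zero    = (K3-receptionCompatible₀ , P3-receptionCompatible) , λ ()
theorem6 (suc m) = (K3-receptionCompatible , P3-receptionCompatible) ,
                   λ _ → K3-evictionCompatible , P3-not-evictionCompatible
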